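{- Let $S\subseteq V=[n]$ with $|S|=k$, and let $\{X_i\}_{i=1}^n,I$ be any feasible solution of the SDP. Then \[\sum_{i\in S,\,j\in V\setminus S}\langle X_i,X_j\rangle\le3k^2\Bigl(1-\mathbb E_{i\sim S}\|X_i\|^2\Bigr).\]
   Context: The SDP (for a weighted adjacency matrix $A$ and integer $k$): variables are vectors $X_1,\dots,X_n,I$ in a real Euclidean space; maximize $\frac12\sum_{i,j}A_{ij}\langle X_i,X_j\rangle$ subject to $\sum_i\|X_i\|^2=k$; $\sum_j\langle X_i,X_j\rangle\le k\|X_i\|^2$ for all $i$; $0\le\langle X_i,X_j\rangle\le\|X_i\|^2$ for $i\ne j$; $\|X_i\|^2\le1$ for all $i$; $\langle X_i,I\rangle=\|X_i\|^2$ for all $i$; $\|I\|^2=1$. $\mathbb E_{i\sim S}$ is the average over $i$ uniform in $S$. -}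

module Defs where

open import Level using (Level; _⊔_) renaming (suc to lsuc)
open import Data.Nat using (ℕ; zero; suc)
open import Data.Fin using (Fin; zero; suc)
open import Data.Bool using (if_then_else_)
open import Data.Vec using (lookup)
open import Data.Fin.Subset using (Subset)
open import Data.Product using (_×_)
open import Relation.Nullary using (¬_)
open import Relation.Binary.PropositionalEquality using (_≢_)
open import Relation.Binary.Core using (Rel)
open import Relation.Binary.Structures using (IsTotalOrder)
open import Algebra.Bundles using (CommutativeRing)

-- An ordered field (the real numbers being the intended instance).
-- Inverse is total, with the convention 0⁻¹ = 0.
record OrderedField (c ℓ₁ ℓ₂ : Level) : Set (lsuc (c ⊔ ℓ₁ ⊔ ℓ₂)) where
  field
    commutativeRing : CommutativeRing c ℓ₁
  open CommutativeRing commutativeRing public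
  field
    _≤_           : Rel Carrier ℓ₂
    isTotalOrder  : IsTotalOrder _≈_ _≤_
    +-mono-≤      : ∀ {x y} z → x ≤ y → (x + z) ≤ (y + z)
    *-nonneg      : ∀ {x y} → 0# ≤ x → 0# ≤ y → 0# ≤ (x * y)
    1≉0           : ¬ (1# ≈ 0#)
    _⁻¹           : Carrier → Carrier
    *-inverse     : ∀ x → ¬ (x ≈ 0#) → (x * (x ⁻¹)) ≈ 1#
    0⁻¹≈0         : (0# ⁻¹) ≈ 0#

module _ {c ℓ₁ ℓ₂} (F : OrderedField c ℓ₁ ℓ₂) where
  open OrderedField F hiding (zero)

  ∑ : (n : ℕ) → (Fin n → Carrier) → Carrier
  ∑ zero    f = 0#
  ∑ (suc n) f = f zero + ∑ n (λ i → f (suc i))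

  ∑∈ : {n : ℕ} → Subset n → (Fin n → Carrier) → Carrier
  ∑∈ {n} S f = ∑ n (λ i → if lookup S i then f i else 0#)

  ∑∉ : {n : ℕ} → Subset n → (Fin n → Carrier) → Carrier
  ∑∉ {n} S f = ∑ n (λ i → if lookup S i then 0# else f i)

  fromℕ : ℕ → Carrier
  fromℕ zero    = 0#
  fromℕ (suc m) = 1# + fromℕ m

  Vect : ℕ → Set c
  Vect d = Fin d → Carrier

  ⟨_,_⟩ : {d : ℕ} → Vect d → Vect d → Carrier
  ⟨_,_⟩ {d} x y = ∑ d (λ l → x l * y l)

  ‖_‖² : {d : ℕ} → Vect d → Carrier
  ‖ x ‖² = ⟨ x , x ⟩

  -- 𝔼_{i ∼ S} f i, for S of size k (uniform average over S)
  𝔼 : {n : ℕ} → (k : ℕ) → Subset n → (Fin n → Carrier) → Carrier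
  𝔼 k S f = (fromℕ k ⁻¹) * ∑∈ S f

  -- Feasibility of (X_1..X_n, I) for the SDP with parameter k.
  -- (The constraints do not involve the weight matrix A.)
  record Feasible {d : ℕ} (n k : ℕ) (X : Fin n → Vect d) (I : Vect d) : Set (c ⊔ ℓ₁ ⊔ ℓ₂) where
    field
      sum-norms  : ∑ n (λ i → ‖ X i ‖²) ≈ fromℕ k
      row-bound  : ∀ i → ∑ n (λ j → ⟨ X i , X j ⟩) ≤ (fromℕ k * ‖ X i ‖²)
      nonneg     : ∀ i j → i ≢ j → 0# ≤ ⟨ X i , X j ⟩
      below-norm : ∀ i j → i ≢ j → ⟨ X i , X j ⟩ ≤ ‖ X i ‖²
      norm-le-1  : ∀ i → ‖ X i ‖² ≤ 1#
      along-I    : ∀ i → ⟨ X i , I ⟩ ≈ ‖ X i ‖²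
      I-unit     : ‖ I ‖² ≈ 1#

module Submission where

-- Write s = ∑_{i ∈ S} ‖X_i‖² and v = ∑_{i ∈ S} X_i. Subtracting the pairs inside S from the
-- row bounds ∑_j ⟨X_i, X_j⟩ ≤ k ‖X_i‖² bounds the cut by k s − ‖v‖². As ⟨v, I⟩ = s and I is a
-- unit vector, Cauchy–Schwarz gives ‖v‖² ≥ s², so the cut is at most s (k − s), and since
-- 0 ≤ s ≤ k this is at most 3 k (k − s) = 3 k² (1 − s / k).

open import Level using (Level)
open import Data.Nat as ℕ using (ℕ; zero; suc)
open import Data.Fin using (Fin; zero; suc)
open import Function using (_∘_)
open import Data.Bool using (true; false; if_then_else_)
open import Data.Vec using ([]; _∷_; lookup)
open import Data.Fin.Subset using (Subset; ∣_∣)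
open import Data.Integer as ℤ using (ℤ; +_; -[1+_])
import Data.Integer.Properties as ℤ
open import Data.Sign as Sign using (Sign)
open import Data.Maybe using (Maybe; just; nothing)
open import Relation.Nullary using (yes; no; ¬_)
open import Relation.Binary.PropositionalEquality as ≡ using (_≡_)
open import Algebra.Bundles using (CommutativeRing)
open import Relation.Binary.Bundles using (Poset)
open import Relation.Binary.Structures using (IsTotalOrder)
open import Data.Sum using (inj₁; inj₂)
open import Defs
open import Algebra.Solver.Ring.AlmostCommutativeRing
  using (fromCommutativeRing; _-Raw-AlmostCommutative⟶_)
import Algebra.Solver.Ring as RingSolver

-- The ring solver needs coefficients with decidable equality, so we use ℤ, interpreted in R.
module IntegerCoefficientSolver {c ℓ} (R : CommutativeRing c ℓ) where
  open CommutativeRing R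
  open import Algebra.Properties.Ring ring
  open import Algebra.Properties.Semiring.Mult semiring
  open import Relation.Binary.Reasoning.Setoid setoid
  open import Algebra.Properties.CommutativeSemigroup +-commutativeSemigroup
    using (x∙yz≈y∙xz; interchange)
  open import Algebra.Properties.CommutativeSemigroup *-commutativeSemigroup
    using () renaming (interchange to *-interchange)

  ⟦_⟧ℤ : ℤ → Carrier
  ⟦ + n ⟧ℤ      = n × 1#
  ⟦ -[1+ n ] ⟧ℤ = - (suc n × 1#)

  ⟦⊖⟧ : ∀ m n → ⟦ m ℤ.⊖ n ⟧ℤ ≈ m × 1# - n × 1#
  ⟦⊖⟧ m zero rewrite ℤ.⊖-≥ (ℕ.z≤n {m}) = sym (trans (+-congˡ -0#≈0#) (+-identityʳ _))
  ⟦⊖⟧ zero (suc n) rewrite ℤ.⊖-< (ℕ.z<s {n}) = sym (+-identityˡ _)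
  ⟦⊖⟧ (suc m) (suc n) rewrite ℤ.[1+m]⊖[1+n]≡m⊖n m n = begin
    ⟦ m ℤ.⊖ n ⟧ℤ                      ≈⟨ ⟦⊖⟧ m n ⟩
    M - N                             ≈⟨ +-identityˡ (M - N) ⟨
    0# + (M - N)                      ≈⟨ +-congʳ (-‿inverseʳ 1#) ⟨
    (1# - 1#) + (M - N)               ≈⟨ interchange 1# (- 1#) M (- N) ⟩
    (1# + M) + (- 1# - N)             ≈⟨ +-congˡ (-‿+-comm 1# N) ⟩
    (1# + M) - (1# + N)               ∎
    where
    M = m × 1#
    N = n × 1#

  ⟦+⟧ : ∀ i j → ⟦ i ℤ.+ j ⟧ℤ ≈ ⟦ i ⟧ℤ + ⟦ j ⟧ℤ
  ⟦+⟧ (+ m)      (+ n)      = ×-homo-+ 1# m n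
  ⟦+⟧ (+ m)      -[1+ n ]   = ⟦⊖⟧ m (suc n)
  ⟦+⟧ -[1+ m ]   (+ n)      = trans (⟦⊖⟧ n (suc m)) (+-comm _ _)
  ⟦+⟧ -[1+ m ]   -[1+ n ]   = begin
    - (1# + (1# + (m ℕ.+ n) × 1#))  ≈⟨ -‿cong (+-congˡ (+-congˡ (×-homo-+ 1# m n))) ⟩
    - (1# + (1# + (M + N)))         ≈⟨ -‿cong (+-congˡ (x∙yz≈y∙xz 1# M N)) ⟩
    - (1# + (M + (1# + N)))         ≈⟨ -‿cong (+-assoc 1# M (1# + N)) ⟨
    - ((1# + M) + (1# + N))         ≈⟨ -‿+-comm (1# + M) (1# + N) ⟨
    - (1# + M) - (1# + N)           ∎
    where
    M = m × 1#
    N = n × 1#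

  ⟦-⟧ : ∀ i → ⟦ ℤ.- i ⟧ℤ ≈ - ⟦ i ⟧ℤ
  ⟦-⟧ (+ zero)    = sym -0#≈0#
  ⟦-⟧ (+ suc n)   = refl
  ⟦-⟧ -[1+ n ]    = sym (-‿involutive _)

  ⟦_⟧± : Sign → Carrier
  ⟦ Sign.+ ⟧± = 1#
  ⟦ Sign.- ⟧± = - 1#

  ⟦*⟧± : ∀ s t → ⟦ s Sign.* t ⟧± ≈ ⟦ s ⟧± * ⟦ t ⟧±
  ⟦*⟧± Sign.+ t      = sym (*-identityˡ _)
  ⟦*⟧± Sign.- Sign.+ = sym (*-identityʳ _)
  ⟦*⟧± Sign.- Sign.- = begin
    1#             ≈⟨ -‿involutive 1# ⟨
    - - 1#         ≈⟨ -‿cong (-1*x≈-x 1#) ⟨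
    - (- 1# * 1#)  ≈⟨ -‿distribʳ-* (- 1#) 1# ⟩
    - 1# * - 1#    ∎

  ⟦◃⟧ : ∀ s n → ⟦ s ℤ.◃ n ⟧ℤ ≈ ⟦ s ⟧± * n × 1#
  ⟦◃⟧ s      zero    = sym (zeroʳ _)
  ⟦◃⟧ Sign.+ (suc n) = sym (*-identityˡ _)
  ⟦◃⟧ Sign.- (suc n) = sym (-1*x≈-x _)

  ⟦⟧≈sign*abs : ∀ i → ⟦ i ⟧ℤ ≈ ⟦ ℤ.sign i ⟧± * ℤ.∣ i ∣ × 1#
  ⟦⟧≈sign*abs (+ n)    = sym (*-identityˡ _)
  ⟦⟧≈sign*abs -[1+ n ] = sym (-1*x≈-x _)

  ⟦*⟧ : ∀ i j → ⟦ i ℤ.* j ⟧ℤ ≈ ⟦ i ⟧ℤ * ⟦ j ⟧ℤ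
  ⟦*⟧ i j = begin
    ⟦ i ℤ.* j ⟧ℤ                  ≈⟨ ⟦◃⟧ (sᵢ Sign.* sⱼ) (∣i∣ ℕ.* ∣j∣) ⟩
    ⟦ sᵢ Sign.* sⱼ ⟧± * (∣i∣ ℕ.* ∣j∣) × 1#
                                  ≈⟨ *-cong (⟦*⟧± sᵢ sⱼ) (×1-homo-* ∣i∣ ∣j∣) ⟩
    (⟦ sᵢ ⟧± * ⟦ sⱼ ⟧±) * (∣i∣ × 1# * ∣j∣ × 1#)
                                  ≈⟨ *-interchange _ _ _ _ ⟩
    (⟦ sᵢ ⟧± * ∣i∣ × 1#) * (⟦ sⱼ ⟧± * ∣j∣ × 1#)
                                  ≈⟨ *-cong (⟦⟧≈sign*abs i) (⟦⟧≈sign*abs j) ⟨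
    ⟦ i ⟧ℤ * ⟦ j ⟧ℤ               ∎
    where
    sᵢ = ℤ.sign i
    sⱼ = ℤ.sign j
    ∣i∣ = ℤ.∣ i ∣
    ∣j∣ = ℤ.∣ j ∣

  ⟦⟧-homomorphism : ℤ.+-*-rawRing -Raw-AlmostCommutative⟶ fromCommutativeRing R
  ⟦⟧-homomorphism = record
    { ⟦_⟧    = ⟦_⟧ℤ
    ; +-homo = ⟦+⟧
    ; *-homo = ⟦*⟧
    ; -‿homo = ⟦-⟧
    ; 0-homo = refl
    ; 1-homo = +-identityʳ 1#
    }

  ⟦⟧-≈? : ∀ i j → Maybe (⟦ i ⟧ℤ ≈ ⟦ j ⟧ℤ)
  ⟦⟧-≈? i j with i ℤ.≟ j
  ... | yes ≡.refl = just refl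
  ... | no _       = nothing

  open RingSolver ℤ.+-*-rawRing (fromCommutativeRing R) ⟦⟧-homomorphism ⟦⟧-≈?
    public using (solve; _:=_; _:+_; _:-_; :-_; _:*_)

module Properties {c ℓ₁ ℓ₂} (F : OrderedField c ℓ₁ ℓ₂) where
  open OrderedField F hiding (zero) renaming (_≤_ to infix 4 _≤_)
  open import Algebra.Properties.Ring ring using (-0#≈0#; x[y-z]≈xy-xz)
  open IntegerCoefficientSolver commutativeRing
  open IsTotalOrder isTotalOrder using (total; antisym)
    renaming (refl to ≤-refl; reflexive to ≤-reflexive; trans to ≤-trans)

  ≤-poset : Poset c ℓ₁ ℓ₂
  ≤-poset = record { isPartialOrder = IsTotalOrder.isPartialOrder isTotalOrder }

  open import Relation.Binary.Reasoning.PartialOrder ≤-poset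

  x-0#≈x : ∀ x → x - 0# ≈ x
  x-0#≈x x = trans (+-congˡ -0#≈0#) (+-identityʳ x)

  x≤y⇒0≤y-x : ∀ {x y} → x ≤ y → 0# ≤ y - x
  x≤y⇒0≤y-x {x} {y} x≤y = begin
    0#     ≈⟨ -‿inverseʳ x ⟨
    x - x  ≤⟨ +-mono-≤ (- x) x≤y ⟩
    y - x  ∎

  0≤y-x⇒x≤y : ∀ {x y} → 0# ≤ y - x → x ≤ y
  0≤y-x⇒x≤y {x} {y} 0≤y-x = begin
    x            ≈⟨ +-identityˡ x ⟨
    0# + x       ≤⟨ +-mono-≤ x 0≤y-x ⟩
    (y - x) + x  ≈⟨ solve 2 (λ x y → (y :- x) :+ x := y) refl x y ⟩
    y            ∎

  +-mono-≤₂ : ∀ {x y u v} → x ≤ y → u ≤ v → x + u ≤ y + v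
  +-mono-≤₂ {x} {y} {u} {v} x≤y u≤v = begin
    x + u  ≤⟨ +-mono-≤ u x≤y ⟩
    y + u  ≈⟨ +-comm y u ⟩
    u + y  ≤⟨ +-mono-≤ y u≤v ⟩
    v + y  ≈⟨ +-comm v y ⟩
    y + v  ∎

  -‿antitone-≤ : ∀ {x y} z → x ≤ y → z - y ≤ z - x
  -‿antitone-≤ {x} {y} z x≤y = 0≤y-x⇒x≤y (begin
    0#                   ≤⟨ x≤y⇒0≤y-x x≤y ⟩
    y - x                ≈⟨ solve 3 (λ x y z → y :- x := (z :- x) :- (z :- y)) refl x y z ⟩
    (z - x) - (z - y)    ∎)

  *-monoˡ-≤-nonneg : ∀ {x y} z → 0# ≤ z → x ≤ y → z * x ≤ z * y
  *-monoˡ-≤-nonneg {x} {y} z 0≤z x≤y = 0≤y-x⇒x≤y (begin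
    0#               ≤⟨ *-nonneg 0≤z (x≤y⇒0≤y-x x≤y) ⟩
    z * (y - x)      ≈⟨ x[y-z]≈xy-xz z y x ⟩
    z * y - z * x    ∎)

  0≤x*x : ∀ x → 0# ≤ x * x
  0≤x*x x with total 0# x
  ... | inj₁ 0≤x = *-nonneg 0≤x 0≤x
  ... | inj₂ x≤0 = begin
    0#         ≤⟨ *-nonneg 0≤-x 0≤-x ⟩
    - x * - x  ≈⟨ solve 1 (λ x → (:- x) :* (:- x) := x :* x) refl x ⟩
    x * x      ∎
    where
    0≤-x : 0# ≤ - x
    0≤-x = begin
      0#      ≈⟨ -‿inverseʳ x ⟨
      x - x   ≤⟨ +-mono-≤ (- x) x≤0 ⟩
      0# - x  ≈⟨ +-identityˡ (- x) ⟩
      - x     ∎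

  0≤1 : 0# ≤ 1#
  0≤1 = ≤-trans (0≤x*x 1#) (≤-reflexive (*-identityˡ 1#))

  0≤fromℕ : ∀ n → 0# ≤ fromℕ F n
  0≤fromℕ zero    = ≤-refl
  0≤fromℕ (suc n) = begin
    0#                ≈⟨ +-identityˡ 0# ⟨
    0# + 0#           ≤⟨ +-mono-≤₂ 0≤1 (0≤fromℕ n) ⟩
    1# + fromℕ F n    ∎

  fromℕ-suc≉0 : ∀ n → ¬ (fromℕ F (suc n) ≈ 0#)
  fromℕ-suc≉0 n 1+n≈0 = 1≉0 (antisym 1≤0 0≤1)
    where
    1≤0 : 1# ≤ 0#
    1≤0 = begin
      1#               ≈⟨ +-identityʳ 1# ⟨
      1# + 0#          ≤⟨ +-mono-≤₂ ≤-refl (0≤fromℕ n) ⟩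
      1# + fromℕ F n   ≈⟨ 1+n≈0 ⟩
      0#               ∎

  x≤fromℕ-suc*x : ∀ n {x} → 0# ≤ x → x ≤ fromℕ F (suc n) * x
  x≤fromℕ-suc*x n {x} 0≤x = begin
    x                       ≈⟨ +-identityʳ x ⟨
    x + 0#                  ≤⟨ +-mono-≤₂ ≤-refl (*-nonneg (0≤fromℕ n) 0≤x) ⟩
    x + fromℕ F n * x       ≈⟨ +-congʳ (*-identityˡ x) ⟨
    1# * x + fromℕ F n * x  ≈⟨ distribʳ x 1# (fromℕ F n) ⟨
    fromℕ F (suc n) * x     ∎

  -- For k = 0 the hypotheses force s = 0, so the convention 0⁻¹ = 0 is harmless.
  fromℕ-*-⁻¹-cancel : ∀ k {s} → 0# ≤ s → s ≤ fromℕ F k → fromℕ F k * (fromℕ F k ⁻¹ * s) ≈ s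
  fromℕ-*-⁻¹-cancel zero    0≤s s≤0 = trans (zeroˡ _) (antisym 0≤s s≤0)
  fromℕ-*-⁻¹-cancel (suc k) {s} _ _ = begin-equality
    K * (K ⁻¹ * s)  ≈⟨ *-assoc K (K ⁻¹) s ⟨
    (K * K ⁻¹) * s  ≈⟨ *-congʳ (*-inverse K (fromℕ-suc≉0 k)) ⟩
    1# * s          ≈⟨ *-identityˡ s ⟩
    s               ∎
    where K = fromℕ F (suc k)

  ∑-cong : ∀ {n} {f g : Fin n → Carrier} → (∀ i → f i ≈ g i) → ∑ F n f ≈ ∑ F n g
  ∑-cong {zero}  f≈g = refl
  ∑-cong {suc n} f≈g = +-cong (f≈g zero) (∑-cong (f≈g ∘ suc))

  ∑-mono-≤ : ∀ {n} {f g : Fin n → Carrier} → (∀ i → f i ≤ g i) → ∑ F n f ≤ ∑ F n g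
  ∑-mono-≤ {zero}  f≤g = ≤-refl
  ∑-mono-≤ {suc n} f≤g = +-mono-≤₂ (f≤g zero) (∑-mono-≤ (f≤g ∘ suc))

  ∑-zero : ∀ n → ∑ F n (λ _ → 0#) ≈ 0#
  ∑-zero zero    = refl
  ∑-zero (suc n) = trans (+-identityˡ _) (∑-zero n)

  ∑-nonneg : ∀ {n} {f : Fin n → Carrier} → (∀ i → 0# ≤ f i) → 0# ≤ ∑ F n f
  ∑-nonneg {n} 0≤f = ≤-trans (≤-reflexive (sym (∑-zero n))) (∑-mono-≤ 0≤f)

  ∑-distrib-+ : ∀ {n} (f g : Fin n → Carrier) → ∑ F n (λ i → f i + g i) ≈ ∑ F n f + ∑ F n g
  ∑-distrib-+ {zero}  f g = sym (+-identityˡ 0#)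
  ∑-distrib-+ {suc n} f g = trans (+-congˡ (∑-distrib-+ (f ∘ suc) (g ∘ suc)))
    (solve 4 (λ a b c d → (a :+ b) :+ (c :+ d) := (a :+ c) :+ (b :+ d)) refl _ _ _ _)

  ∑-distrib-− : ∀ {n} (f g : Fin n → Carrier) → ∑ F n (λ i → f i - g i) ≈ ∑ F n f - ∑ F n g
  ∑-distrib-− {zero}  f g = sym (x-0#≈x 0#)
  ∑-distrib-− {suc n} f g = trans (+-congˡ (∑-distrib-− (f ∘ suc) (g ∘ suc)))
    (solve 4 (λ a b c d → (a :- b) :+ (c :- d) := (a :+ c) :- (b :+ d)) refl _ _ _ _)

  *-distribˡ-∑ : ∀ {n} x (f : Fin n → Carrier) → x * ∑ F n f ≈ ∑ F n (λ i → x * f i)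
  *-distribˡ-∑ {zero}  x f = zeroʳ x
  *-distribˡ-∑ {suc n} x f = trans (distribˡ x _ _) (+-congˡ (*-distribˡ-∑ x (f ∘ suc)))

  *-distribʳ-∑ : ∀ {n} x (f : Fin n → Carrier) → ∑ F n f * x ≈ ∑ F n (λ i → f i * x)
  *-distribʳ-∑ {zero}  x f = zeroˡ x
  *-distribʳ-∑ {suc n} x f = trans (distribʳ x _ _) (+-congˡ (*-distribʳ-∑ x (f ∘ suc)))

  ∑-comm : ∀ m n (f : Fin m → Fin n → Carrier) →
           ∑ F m (λ i → ∑ F n (f i)) ≈ ∑ F n (λ j → ∑ F m (λ i → f i j))
  ∑-comm zero    n f = sym (∑-zero n)
  ∑-comm (suc m) n f = trans (+-congˡ (∑-comm m n (f ∘ suc)))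
    (sym (∑-distrib-+ (f zero) (λ j → ∑ F m (λ i → f (suc i) j))))

  module _ {n} (S : Subset n) where

    ∑∈-cong : {f g : Fin n → Carrier} → (∀ i → f i ≈ g i) → ∑∈ F S f ≈ ∑∈ F S g
    ∑∈-cong f≈g = ∑-cong λ i → when (lookup S i) (f≈g i)
      where
      when : ∀ b {x y} → x ≈ y → (if b then x else 0#) ≈ (if b then y else 0#)
      when true  x≈y = x≈y
      when false _   = refl

    ∑∈-mono-≤ : {f g : Fin n → Carrier} → (∀ i → f i ≤ g i) → ∑∈ F S f ≤ ∑∈ F S g
    ∑∈-mono-≤ f≤g = ∑-mono-≤ λ i → when (lookup S i) (f≤g i)
      where
      when : ∀ b {x y} → x ≤ y → (if b then x else 0#) ≤ (if b then y else 0#)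
      when true  x≤y = x≤y
      when false _   = ≤-refl

    ∑∈-nonneg : {f : Fin n → Carrier} → (∀ i → 0# ≤ f i) → 0# ≤ ∑∈ F S f
    ∑∈-nonneg 0≤f = ∑-nonneg λ i → when (lookup S i) (0≤f i)
      where
      when : ∀ b {x} → 0# ≤ x → 0# ≤ (if b then x else 0#)
      when true  0≤x = 0≤x
      when false _   = ≤-refl

    ∑∈-distrib-− : (f g : Fin n → Carrier) → ∑∈ F S (λ i → f i - g i) ≈ ∑∈ F S f - ∑∈ F S g
    ∑∈-distrib-− f g = trans (∑-cong λ i → when (lookup S i) (f i) (g i)) (∑-distrib-− {n} _ _)
      where
      when : ∀ b x y → (if b then x - y else 0#) ≈ (if b then x else 0#) - (if b then y else 0#)
      when true  _ _ = refl
      when false _ _ = sym (x-0#≈x 0#)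

    *-distribˡ-∑∈ : ∀ x (f : Fin n → Carrier) → x * ∑∈ F S f ≈ ∑∈ F S (λ i → x * f i)
    *-distribˡ-∑∈ x f = trans (*-distribˡ-∑ {n} x _) (∑-cong λ i → when (lookup S i) (f i))
      where
      when : ∀ b y → x * (if b then y else 0#) ≈ (if b then x * y else 0#)
      when true  _ = refl
      when false _ = zeroʳ x

    *-distribʳ-∑∈ : ∀ x (f : Fin n → Carrier) → ∑∈ F S f * x ≈ ∑∈ F S (λ i → f i * x)
    *-distribʳ-∑∈ x f = trans (*-distribʳ-∑ {n} x _) (∑-cong λ i → when (lookup S i) (f i))
      where
      when : ∀ b y → (if b then y else 0#) * x ≈ (if b then y * x else 0#)
      when true  _ = refl
      when false _ = zeroˡ x

    ∑-∑∈-comm : ∀ m (f : Fin m → Fin n → Carrier) →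
                ∑ F m (λ l → ∑∈ F S (f l)) ≈ ∑∈ F S (λ i → ∑ F m (λ l → f l i))
    ∑-∑∈-comm m f = trans (∑-comm m n _) (∑-cong λ i → when (lookup S i) (λ l → f l i))
      where
      when : ∀ b (g : Fin m → Carrier) → ∑ F m (λ l → if b then g l else 0#) ≈ (if b then ∑ F m g else 0#)
      when true  _ = refl
      when false _ = ∑-zero m

    ∑∉≈∑-∑∈ : (f : Fin n → Carrier) → ∑∉ F S f ≈ ∑ F n f - ∑∈ F S f
    ∑∉≈∑-∑∈ f = trans (∑-cong λ i → when (lookup S i) (f i)) (∑-distrib-− f _)
      where
      when : ∀ b x → (if b then 0# else x) ≈ x - (if b then x else 0#)
      when true  x = sym (-‿inverseʳ x)
      when false x = sym (x-0#≈x x)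

  ∑∈-1≈∣S∣ : ∀ {n} (S : Subset n) → ∑∈ F S (λ _ → 1#) ≈ fromℕ F ∣ S ∣
  ∑∈-1≈∣S∣ []          = refl
  ∑∈-1≈∣S∣ (true ∷ S)  = +-congˡ (∑∈-1≈∣S∣ S)
  ∑∈-1≈∣S∣ (false ∷ S) = trans (+-identityˡ _) (∑∈-1≈∣S∣ S)

  ⟪_,_⟫ : ∀ {d} → Vect F d → Vect F d → Carrier
  ⟪ x , y ⟫ = ⟨_,_⟩ F x y

  ∑∈ᵥ : ∀ {d n} → Subset n → (Fin n → Vect F d) → Vect F d
  ∑∈ᵥ S X l = ∑∈ F S (λ i → X i l)

  ⟪∑∈ᵥ,⟫ : ∀ {d n} (S : Subset n) (X : Fin n → Vect F d) y →
             ⟪ ∑∈ᵥ S X , y ⟫ ≈ ∑∈ F S (λ i → ⟪ X i , y ⟫)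
  ⟪∑∈ᵥ,⟫ {d} S X y = begin-equality
    ∑ F d (λ l → ∑∈ F S (λ i → X i l) * y l)    ≈⟨ ∑-cong (λ l → *-distribʳ-∑∈ S (y l) (λ i → X i l)) ⟩
    ∑ F d (λ l → ∑∈ F S (λ i → X i l * y l))    ≈⟨ ∑-∑∈-comm S d (λ l i → X i l * y l) ⟩
    ∑∈ F S (λ i → ⟪ X i , y ⟫)                   ∎

  ⟪,∑∈ᵥ⟫ : ∀ {d n} x (S : Subset n) (Y : Fin n → Vect F d) →
             ⟪ x , ∑∈ᵥ S Y ⟫ ≈ ∑∈ F S (λ i → ⟪ x , Y i ⟫)
  ⟪,∑∈ᵥ⟫ {d} x S Y = begin-equality
    ∑ F d (λ l → x l * ∑∈ F S (λ i → Y i l))    ≈⟨ ∑-cong (λ l → *-distribˡ-∑∈ S (x l) (λ i → Y i l)) ⟩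
    ∑ F d (λ l → ∑∈ F S (λ i → x l * Y i l))    ≈⟨ ∑-∑∈-comm S d (λ l i → x l * Y i l) ⟩
    ∑∈ F S (λ i → ⟪ x , Y i ⟫)                   ∎

  ‖x-tu‖² : ∀ {d} (x u : Vect F d) t →
            ∑ F d (λ l → (x l - t * u l) * (x l - t * u l)) ≈ (⟪ x , x ⟫ - (t + t) * ⟪ x , u ⟫) + (t * t) * ⟪ u , u ⟫
  ‖x-tu‖² {d} x u t = begin-equality
    ∑ F d (λ l → (x l - t * u l) * (x l - t * u l))
      ≈⟨ ∑-cong (λ l → solve 3 (λ x u t → (x :- t :* u) :* (x :- t :* u)
                                    := (x :* x :- (t :+ t) :* (x :* u)) :+ (t :* t) :* (u :* u)) refl (x l) (u l) t) ⟩
    ∑ F d (λ l → (x l * x l - (t + t) * (x l * u l)) + (t * t) * (u l * u l))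
      ≈⟨ ∑-distrib-+ (λ l → x l * x l - (t + t) * (x l * u l)) (λ l → (t * t) * (u l * u l)) ⟩
    ∑ F d (λ l → x l * x l - (t + t) * (x l * u l)) + ∑ F d (λ l → (t * t) * (u l * u l))
      ≈⟨ +-congʳ (∑-distrib-− (λ l → x l * x l) (λ l → (t + t) * (x l * u l))) ⟩
    (⟪ x , x ⟫ - ∑ F d (λ l → (t + t) * (x l * u l))) + ∑ F d (λ l → (t * t) * (u l * u l))
      ≈⟨ +-cong (+-congˡ (-‿cong (*-distribˡ-∑ (t + t) (λ l → x l * u l)))) (*-distribˡ-∑ (t * t) (λ l → u l * u l)) ⟨
    (⟪ x , x ⟫ - (t + t) * ⟪ x , u ⟫) + (t * t) * ⟪ u , u ⟫
      ∎

  ⟪x,u⟫²≤‖x‖² : ∀ {d} (x u : Vect F d) → ⟪ u , u ⟫ ≈ 1# → ⟪ x , u ⟫ * ⟪ x , u ⟫ ≤ ⟪ x , x ⟫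
  ⟪x,u⟫²≤‖x‖² x u ‖u‖²≈1 = 0≤y-x⇒x≤y (begin
    0#                                                  ≤⟨ ∑-nonneg (λ l → 0≤x*x (x l - t * u l)) ⟩
    ∑ F _ (λ l → (x l - t * u l) * (x l - t * u l))     ≈⟨ ‖x-tu‖² x u t ⟩
    (⟪ x , x ⟫ - (t + t) * t) + (t * t) * ⟪ u , u ⟫     ≈⟨ +-congˡ (trans (*-congˡ ‖u‖²≈1) (*-identityʳ (t * t))) ⟩
    (⟪ x , x ⟫ - (t + t) * t) + t * t                   ≈⟨ solve 2 (λ a t → (a :- (t :+ t) :* t) :+ t :* t := a :- t :* t) refl ⟪ x , x ⟫ t ⟩
    ⟪ x , x ⟫ - t * t                                   ∎)
    where t = ⟪ x , u ⟫

  ∑∈∑∉≤ : ∀ {d n} (S : Subset n) (X : Fin n → Vect F d) K →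
          (∀ i → ∑ F n (λ j → ⟪ X i , X j ⟫) ≤ K * ⟪ X i , X i ⟫) →
          ∑∈ F S (λ i → ∑∉ F S (λ j → ⟪ X i , X j ⟫)) ≤ K * ∑∈ F S (λ i → ⟪ X i , X i ⟫) - ⟪ ∑∈ᵥ S X , ∑∈ᵥ S X ⟫
  ∑∈∑∉≤ {n = n} S X K row-bound = begin
    ∑∈ F S (λ i → ∑∉ F S (g i))                         ≈⟨ ∑∈-cong S (λ i → ∑∉≈∑-∑∈ S (g i)) ⟩
    ∑∈ F S (λ i → ∑ F n (g i) - ∑∈ F S (g i))            ≤⟨ ∑∈-mono-≤ S (λ i → +-mono-≤ _ (row-bound i)) ⟩
    ∑∈ F S (λ i → K * g i i - ∑∈ F S (g i))              ≈⟨ ∑∈-distrib-− S _ _ ⟩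
    ∑∈ F S (λ i → K * g i i) - ∑∈ F S (λ i → ∑∈ F S (g i))
      ≈⟨ +-cong (*-distribˡ-∑∈ S K (λ i → g i i)) (-‿cong ‖v‖²) ⟨
    K * ∑∈ F S (λ i → g i i) - ⟪ v , v ⟫                ∎
    where
    g : Fin n → Fin n → Carrier
    g i j = ⟪ X i , X j ⟫
    v = ∑∈ᵥ S X
    ‖v‖² : ⟪ v , v ⟫ ≈ ∑∈ F S (λ i → ∑∈ F S (g i))
    ‖v‖² = trans (⟪∑∈ᵥ,⟫ S X v) (∑∈-cong S (λ i → ⟪,∑∈ᵥ⟫ (X i) S X))

  ks-s²≤3k²[1-s/k] : ∀ k {s} → 0# ≤ s → s ≤ fromℕ F k →
                     fromℕ F k * s - s * s ≤ (fromℕ F 3 * (fromℕ F k * fromℕ F k)) * (1# - fromℕ F k ⁻¹ * s)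
  ks-s²≤3k²[1-s/k] k {s} 0≤s s≤K = begin
    K * s - s * s                 ≈⟨ solve 2 (λ K s → K :* s :- s :* s := (K :- s) :* s) refl K s ⟩
    (K - s) * s                   ≤⟨ *-monoˡ-≤-nonneg (K - s) 0≤K-s s≤K ⟩
    (K - s) * K                   ≤⟨ x≤fromℕ-suc*x 2 (*-nonneg 0≤K-s (0≤fromℕ k)) ⟩
    T * ((K - s) * K)             ≈⟨ *-congˡ (*-congʳ (+-congˡ (-‿cong (fromℕ-*-⁻¹-cancel k 0≤s s≤K)))) ⟨
    T * ((K - K * y) * K)         ≈⟨ solve 3 (λ T K y → T :* ((K :- K :* y) :* K) := T :* (K :* K) :- (T :* (K :* K)) :* y) refl T K y ⟩
    T * (K * K) - (T * (K * K)) * y  ≈⟨ +-congʳ (*-identityʳ _) ⟨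
    (T * (K * K)) * 1# - (T * (K * K)) * y  ≈⟨ x[y-z]≈xy-xz _ 1# y ⟨
    (T * (K * K)) * (1# - y)      ∎
    where
    K = fromℕ F k
    T = fromℕ F 3
    y = K ⁻¹ * s
    0≤K-s : 0# ≤ K - s
    0≤K-s = x≤y⇒0≤y-x s≤K

lemma2p5 : ∀ {c ℓ₁ ℓ₂ : Level} (F : OrderedField c ℓ₁ ℓ₂) (d n k : ℕ)
             (S : Subset n) → ∣ S ∣ ≡ k →
             (X : Fin n → Vect F d) (I : Vect F d) → Feasible F n k X I →
             OrderedField._≤_ F
               (∑∈ F S (λ i → ∑∉ F S (λ j → ⟨_,_⟩ F (X i) (X j))))
               (OrderedField._*_ F (OrderedField._*_ F (fromℕ F 3) (OrderedField._*_ F (fromℕ F k) (fromℕ F k)))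
                 (OrderedField._-_ F (OrderedField.1# F) (𝔼 F k S (λ i → ‖_‖² F (X i)))))
lemma2p5 F d n k S ≡.refl X I feasible = begin
  ∑∈ F S (λ i → ∑∉ F S (λ j → ⟪ X i , X j ⟫))  ≤⟨ ∑∈∑∉≤ S X K row-bound ⟩
  K * s - ⟪ v , v ⟫                              ≤⟨ -‿antitone-≤ (K * s) s²≤‖v‖² ⟩
  K * s - s * s                                  ≤⟨ ks-s²≤3k²[1-s/k] k 0≤s s≤K ⟩
  (fromℕ F 3 * (K * K)) * (1# - K ⁻¹ * s)        ∎
  where
  open OrderedField F hiding (zero) renaming (_≤_ to infix 4 _≤_)
  open Feasible feasible
  open Properties F
  open import Relation.Binary.Reasoning.PartialOrder ≤-poset
  K = fromℕ F k
  s = ∑∈ F S (λ i → ⟪ X i , X i ⟫)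
  v = ∑∈ᵥ S X

  s≈⟪v,I⟫ : s ≈ ⟪ v , I ⟫
  s≈⟪v,I⟫ = sym (trans (⟪∑∈ᵥ,⟫ S X I) (∑∈-cong S along-I))

  s²≤‖v‖² : s * s ≤ ⟪ v , v ⟫
  s²≤‖v‖² = begin
    s * s              ≈⟨ *-cong s≈⟪v,I⟫ s≈⟪v,I⟫ ⟩
    ⟪ v , I ⟫ * ⟪ v , I ⟫  ≤⟨ ⟪x,u⟫²≤‖x‖² v I I-unit ⟩
    ⟪ v , v ⟫          ∎

  0≤s : 0# ≤ s
  0≤s = ∑∈-nonneg S (λ i → ∑-nonneg (λ l → 0≤x*x (X i l)))

  s≤K : s ≤ K
  s≤K = begin
    s                       ≤⟨ ∑∈-mono-≤ S norm-le-1 ⟩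
    ∑∈ F S (λ _ → 1#)       ≈⟨ ∑∈-1≈∣S∣ S ⟩
    K                       ∎
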